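{- Let $m\ge 3$ and suppose $x_{i,j}$ is a non-negative integer for each $i\in[3]$ and $j\in[m^2]$. For each $i\in[3]$, suppose $n_i=x_{i,1}=\cdots=x_{i,m}\le x_{i,m+1}=\cdots=x_{i,m(m-1)}\le x_{i,m(m-1)+1}=\cdots=x_{i,m^2}=n_i+1$ for some $n_i\ge 0$, and suppose $n_1\le n_2$ and $n_1\le n_3$. Let $N=|\{j\in[m^2]:x_{1,j}=n_1\}|\in\{m,m(m-1)\}$. Let $f$ be the permutation of $[m^2]$ given by $f(j)=m^2+1-j$, and $g$ the permutation of $[m^2]$ given by $g(j)=m^2+j-N$ if $j\in[N]$ and $g(j)=j-N$ otherwise. Then for any permutations $\sigma_1,\sigma_2$ of $[m^2]$, $$\sum_{j=1}^{m^2}x_{1,j}x_{2,f(j)}x_{3,g(j)}\le\sum_{j=1}^{m^2}x_{1,j}x_{2,\sigma_1(j)}x_{3,\sigma_2(j)}.$$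
   Context: $[k]=\{1,\ldots,k\}$. -}

module Defs where

open import Data.Nat using (ℕ; zero; suc; _+_; _*_; _∸_; _≤_; _<_; _≡ᵇ_; _≤?_; _<?_)
open import Data.Nat.Properties
open import Data.Fin using (Fin; toℕ; fromℕ<; opposite)
import Data.Fin as F
open import Data.Fin.Properties using (toℕ<n)
open import Data.Bool using (if_then_else_)
open import Data.Product using (Σ; _×_; _,_)
open import Relation.Binary.PropositionalEquality using (_≡_; subst; sym)
open import Relation.Nullary using (yes; no)

-- Sum over Fin k (indices 0..k-1, i.e. [k] shifted by one).
ΣFin : ∀ {k} → (Fin k → ℕ) → ℕ
ΣFin {zero}  f = 0
ΣFin {suc k} f = f F.zero + ΣFin (λ j → f (F.suc j))

countEq : ∀ {k} → (Fin k → ℕ) → ℕ → ℕ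
countEq x n = ΣFin (λ j → if x j ≡ᵇ n then 1 else 0)

BlockShape : (m : ℕ) → (Fin (m * m) → ℕ) → ℕ → Set
BlockShape m x n =
  Σ ℕ λ c → (n ≤ c) × (c ≤ suc n) ×
    ((j : Fin (m * m)) →
       (toℕ j < m → x j ≡ n) ×
       (m ≤ toℕ j → toℕ j < m * (m ∸ 1) → x j ≡ c) ×
       (m * (m ∸ 1) ≤ toℕ j → x j ≡ suc n))

-- f(j) = m²+1-j in 1-based indexing, i.e. j ↦ k-1-j in 0-based.
revPerm : ∀ {k} → Fin k → Fin k
revPerm = opposite

private
  lemma : ∀ {j N k} → j < N → j < k → j + (k ∸ N) < k
  lemma {j} {N} {k} j<N j<k with N ≤? k
  ... | yes N≤k = subst (j + (k ∸ N) <_) (m+[n∸m]≡n N≤k) (+-monoˡ-< (k ∸ N) j<N)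
  ... | no N≰k = subst (λ t → j + t < k) (sym (m≤n⇒m∸n≡0 (<⇒≤ (≰⇒> N≰k))))
                   (subst (_< k) (sym (+-identityʳ j)) j<k)

-- g(j) = k + j - N if j ∈ [N], and j - N otherwise (1-based);
-- in 0-based indexing: j ↦ j + (k - N) if j < N, j - N otherwise.
rotPerm : ∀ {k} → ℕ → Fin k → Fin k
rotPerm {k} N j with toℕ j <? N
... | yes j<N = fromℕ< (lemma {toℕ j} {N} {k} j<N (toℕ<n j))
... | no  _   = fromℕ< (≤-<-trans (m∸n≤m (toℕ j) N) (toℕ<n j))

{-# OPTIONS --safe #-}
module Submission where

-- Write xᵢ j = nᵢ + uᵢ j, where uᵢ is the 0/1 indicator of the positions from the jump of xᵢ on.
-- Expanding the product, Σⱼ x₁ x₂ x₃ is a quantity fixed by the sizes Σ uᵢ plus the interaction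
-- n₁ |U₂ ∩ U₃| + n₂ |U₁ ∩ U₃| + n₃ |U₁ ∩ U₂| + |U₁ ∩ U₂ ∩ U₃| of the three indicator sets, and
-- permuting U₂ and U₃ does not change their sizes. Inclusion–exclusion gives lower bounds
-- |A ∩ B| ≥ |A| + |B| − K, |A ∩ B ∩ C| ≥ |A| + |B| + |C| − 2K and
-- |A ∩ B| + |A ∩ C| + |B ∩ C| ≥ |A| + |B| + |C| − K, each attained exactly by configurations that
-- satisfy it with equality at every position. Reversing U₂ and rotating U₃ by N = |∁U₁| places
-- the jumps so that either every overlap is individually minimal, or U₁ ∩ U₃ = ∅ and the
-- n₃-weighted overlap |U₁ ∩ U₂| can be traded for the n₁-weighted total overlap, which is where
-- n₁ ≤ n₂ and n₁ ≤ n₃ enter.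

open import Defs
open import Data.Nat using (ℕ; zero; suc; _+_; _*_; _∸_; _≤_; _<_; z≤n; s≤s; _≡ᵇ_; _<?_; _≤?_)
open import Data.Nat.Properties
open import Data.Nat.Tactic.RingSolver using (solve)
open import Data.Fin using (Fin; toℕ; opposite)
import Data.Fin as F
open import Data.Fin.Properties using (toℕ<n; toℕ-fromℕ<; toℕ-injective; opposite-prop)
open import Data.Fin.Permutation using (Permutation′; _⟨$⟩ʳ_; permutation; reverse)
open import Data.Bool using (if_then_else_)
open import Data.List using (_∷_; [])
open import Data.Product using (Σ; _×_; _,_; proj₁; proj₂)
open import Data.Sum using (_⊎_; inj₁; inj₂; [_,_])
open import Function using (_∘_)
open import Relation.Nullary using (yes; no; contradiction)
open import Relation.Binary.PropositionalEquality
  using (_≡_; refl; sym; trans; cong; cong₂; subst; subst₂; module ≡-Reasoning)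
import Algebra.Properties.Semiring.Sum as SemiringSum
import Algebra.Properties.CommutativeSemigroup as CommutativeSemigroupProperties

private module Sum = SemiringSum +-*-semiring
open CommutativeSemigroupProperties +-commutativeSemigroup
  using () renaming (xy∙z≈xz∙y to +-right-comm)
open CommutativeSemigroupProperties *-commutativeSemigroup
  using () renaming (xy∙z≈xz∙y to *-right-comm)

ΣFin≡sum : ∀ {K} (f : Fin K → ℕ) → ΣFin f ≡ Sum.sum f
ΣFin≡sum {zero}  f = refl
ΣFin≡sum {suc K} f = cong (f F.zero +_) (ΣFin≡sum (f ∘ F.suc))

ΣFin-cong : ∀ {K} {f g : Fin K → ℕ} → (∀ j → f j ≡ g j) → ΣFin f ≡ ΣFin g
ΣFin-cong {zero}  f≗g = refl
ΣFin-cong {suc K} f≗g = cong₂ _+_ (f≗g F.zero) (ΣFin-cong (f≗g ∘ F.suc))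

ΣFin-mono : ∀ {K} {f g : Fin K → ℕ} → (∀ j → f j ≤ g j) → ΣFin f ≤ ΣFin g
ΣFin-mono {zero}  f≤g = z≤n
ΣFin-mono {suc K} f≤g = +-mono-≤ (f≤g F.zero) (ΣFin-mono (f≤g ∘ F.suc))

ΣFin-vanishing : ∀ {K} {f : Fin K → ℕ} → (∀ j → f j ≡ 0) → ΣFin f ≡ 0
ΣFin-vanishing {zero}  f≗0 = refl
ΣFin-vanishing {suc K} f≗0 = cong₂ _+_ (f≗0 F.zero) (ΣFin-vanishing (f≗0 ∘ F.suc))

ΣFin-prefix : ∀ {K T} {f : Fin K → ℕ} → T ≤ K →
  (∀ j → toℕ j < T → f j ≡ 1) → (∀ j → T ≤ toℕ j → f j ≡ 0) → ΣFin f ≡ T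
ΣFin-prefix {zero}  {zero}  _         _   _   = refl
ΣFin-prefix {suc K} {zero}  _         _   f≡0 =
  cong₂ _+_ (f≡0 F.zero z≤n) (ΣFin-prefix z≤n (λ _ ()) (λ j _ → f≡0 (F.suc j) z≤n))
ΣFin-prefix {suc K} {suc T} (s≤s T≤K) f≡1 f≡0 =
  cong₂ _+_ (f≡1 F.zero (s≤s z≤n))
            (ΣFin-prefix T≤K (λ j → f≡1 (F.suc j) ∘ s≤s) (λ j → f≡0 (F.suc j) ∘ s≤s))

ΣFin-+ : ∀ {K} (f g : Fin K → ℕ) → ΣFin (λ j → f j + g j) ≡ ΣFin f + ΣFin g
ΣFin-+ f g = begin
  ΣFin (λ j → f j + g j)    ≡⟨ ΣFin≡sum (λ j → f j + g j) ⟩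
  Sum.sum (λ j → f j + g j) ≡⟨ Sum.∑-distrib-+ f g ⟩
  Sum.sum f + Sum.sum g     ≡⟨ cong₂ _+_ (ΣFin≡sum f) (ΣFin≡sum g) ⟨
  ΣFin f + ΣFin g           ∎
  where open ≡-Reasoning

ΣFin-+₃ : ∀ {K} (f g h : Fin K → ℕ) → ΣFin (λ j → f j + g j + h j) ≡ ΣFin f + ΣFin g + ΣFin h
ΣFin-+₃ f g h = trans (ΣFin-+ (λ j → f j + g j) h) (cong (_+ ΣFin h) (ΣFin-+ f g))

ΣFin-+-cong : ∀ {K} {f g f′ g′ : Fin K → ℕ} → ΣFin f ≡ ΣFin f′ → ΣFin g ≡ ΣFin g′ →
  ΣFin (λ j → f j + g j) ≡ ΣFin (λ j → f′ j + g′ j)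
ΣFin-+-cong {f = f} {g} {f′} {g′} Σf≡ Σg≡ =
  trans (ΣFin-+ f g) (trans (cong₂ _+_ Σf≡ Σg≡) (sym (ΣFin-+ f′ g′)))

ΣFin-+₃-cong : ∀ {K} (f g h f′ g′ h′ : Fin K → ℕ) →
  ΣFin f ≡ ΣFin f′ → ΣFin g ≡ ΣFin g′ → ΣFin h ≡ ΣFin h′ →
  ΣFin (λ j → f j + g j + h j) ≡ ΣFin (λ j → f′ j + g′ j + h′ j)
ΣFin-+₃-cong f g h f′ g′ h′ Σf≡ Σg≡ Σh≡ =
  ΣFin-+-cong {f = λ j → f j + g j} {h} {λ j → f′ j + g′ j} {h′}
    (ΣFin-+-cong {f = f} {g} {f′} {g′} Σf≡ Σg≡) Σh≡

ΣFin-*ˡ : ∀ {K} a (f : Fin K → ℕ) → ΣFin (λ j → a * f j) ≡ a * ΣFin f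
ΣFin-*ˡ a f = begin
  ΣFin (λ j → a * f j)    ≡⟨ ΣFin≡sum (λ j → a * f j) ⟩
  Sum.sum (λ j → a * f j) ≡⟨ Sum.*-distribˡ-sum a f ⟨
  a * Sum.sum f           ≡⟨ cong (a *_) (ΣFin≡sum f) ⟨
  a * ΣFin f              ∎
  where open ≡-Reasoning

ΣFin-linear₃ : ∀ {K} a b c (f g h : Fin K → ℕ) →
  ΣFin (λ j → a * f j + b * g j + c * h j) ≡ a * ΣFin f + b * ΣFin g + c * ΣFin h
ΣFin-linear₃ a b c f g h = trans (ΣFin-+₃ (λ j → a * f j) (λ j → b * g j) (λ j → c * h j))
  (cong₂ _+_ (cong₂ _+_ (ΣFin-*ˡ a f) (ΣFin-*ˡ b g)) (ΣFin-*ˡ c h))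

ΣFin-permute : ∀ {K} (f : Fin K → ℕ) (π : Permutation′ K) → ΣFin (λ j → f (π ⟨$⟩ʳ j)) ≡ ΣFin f
ΣFin-permute f π =
  trans (ΣFin≡sum (λ j → f (π ⟨$⟩ʳ j))) (trans (sym (Sum.sum-permute f π)) (sym (ΣFin≡sum f)))

ΣFin-tight-minimal : ∀ {K} c {f g f′ g′ : Fin K → ℕ} →
  (∀ j → f j ≡ c + g j) → (∀ j → f′ j ≤ c + g′ j) → ΣFin f ≡ ΣFin f′ → ΣFin g ≤ ΣFin g′
ΣFin-tight-minimal {K} c {f} {g} {f′} {g′} tight bound Σf≡ = +-cancelˡ-≤ C _ _ (begin
  C + ΣFin g            ≡⟨ ΣFin-+ (λ _ → c) g ⟨
  ΣFin (λ j → c + g j)  ≡⟨ ΣFin-cong tight ⟨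
  ΣFin f                ≡⟨ Σf≡ ⟩
  ΣFin f′               ≤⟨ ΣFin-mono bound ⟩
  ΣFin (λ j → c + g′ j) ≡⟨ ΣFin-+ (λ _ → c) g′ ⟩
  C + ΣFin g′           ∎)
  where
  open ≤-Reasoning
  C : ℕ
  C = ΣFin {K} (λ _ → c)

-- Indicator vectors, their overlaps and the interaction

data Bit : ℕ → Set where
  0b : Bit 0
  1b : Bit 1

Bits : ∀ {K} → (Fin K → ℕ) → Set
Bits u = ∀ j → Bit (u j)

Disjoint : ∀ {K} → (Fin K → ℕ) → (Fin K → ℕ) → Set
Disjoint u v = ∀ j → u j ≡ 0 ⊎ v j ≡ 0

Cover₂ : ∀ {K} → (Fin K → ℕ) → (Fin K → ℕ) → Set
Cover₂ u v = ∀ j → u j ≡ 1 ⊎ v j ≡ 1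

Cover₃ : ∀ {K} → (Fin K → ℕ) → (Fin K → ℕ) → (Fin K → ℕ) → Set
Cover₃ u v w = ∀ j → u j ≡ 1 ⊎ v j ≡ 1 ⊎ w j ≡ 1

∣_∩_∣ : ∀ {K} → (Fin K → ℕ) → (Fin K → ℕ) → ℕ
∣ u ∩ v ∣ = ΣFin (λ j → u j * v j)

∣_∩_∩_∣ : ∀ {K} → (Fin K → ℕ) → (Fin K → ℕ) → (Fin K → ℕ) → ℕ
∣ u ∩ v ∩ w ∣ = ΣFin (λ j → u j * v j * w j)

overlaps : ∀ {K} → (Fin K → ℕ) → (Fin K → ℕ) → (Fin K → ℕ) → ℕ
overlaps u v w = ∣ v ∩ w ∣ + ∣ u ∩ w ∣ + ∣ u ∩ v ∣

interaction : ∀ {K} → ℕ → ℕ → ℕ → (Fin K → ℕ) → (Fin K → ℕ) → (Fin K → ℕ) → ℕ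
interaction n₁ n₂ n₃ u v w = n₁ * ∣ v ∩ w ∣ + n₂ * ∣ u ∩ w ∣ + n₃ * ∣ u ∩ v ∣ + ∣ u ∩ v ∩ w ∣

-- Inequalities between closed numerals are decided by evaluation.
bit-+-≤ : ∀ {u v} → Bit u → Bit v → u + v ≤ 1 + u * v
bit-+-≤ 0b 0b = ≤ᵇ⇒≤ _ _ _
bit-+-≤ 0b 1b = ≤ᵇ⇒≤ _ _ _
bit-+-≤ 1b 0b = ≤ᵇ⇒≤ _ _ _
bit-+-≤ 1b 1b = ≤ᵇ⇒≤ _ _ _

bit-* : ∀ {u v} → Bit u → Bit v → Bit (u * v)
bit-* 0b _  = 0b
bit-* 1b 0b = 0b
bit-* 1b 1b = 1b

bit-+-≤₃ : ∀ {u v w} → Bit u → Bit v → Bit w → u + v + w ≤ 2 + u * v * w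
bit-+-≤₃ bu bv bw = ≤-trans (+-monoˡ-≤ _ (bit-+-≤ bu bv)) (s≤s (bit-+-≤ (bit-* bu bv) bw))

bit-+-≤-overlaps : ∀ {u v w} → Bit u → Bit v → Bit w → u + v + w ≤ 1 + (v * w + u * w + u * v)
bit-+-≤-overlaps 0b 0b 0b = ≤ᵇ⇒≤ _ _ _
bit-+-≤-overlaps 0b 0b 1b = ≤ᵇ⇒≤ _ _ _
bit-+-≤-overlaps 0b 1b 0b = ≤ᵇ⇒≤ _ _ _
bit-+-≤-overlaps 0b 1b 1b = ≤ᵇ⇒≤ _ _ _
bit-+-≤-overlaps 1b 0b 0b = ≤ᵇ⇒≤ _ _ _
bit-+-≤-overlaps 1b 0b 1b = ≤ᵇ⇒≤ _ _ _
bit-+-≤-overlaps 1b 1b 0b = ≤ᵇ⇒≤ _ _ _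
bit-+-≤-overlaps 1b 1b 1b = ≤ᵇ⇒≤ _ _ _

covered-+ : ∀ {u v} → u ≡ 1 ⊎ v ≡ 1 → u + v ≡ 1 + u * v
covered-+ {v = v} (inj₁ refl) = solve (v ∷ [])
covered-+ {u = u} (inj₂ refl) = solve (u ∷ [])

doubly-covered-+ : ∀ {u v w} → u ≡ 1 ⊎ v ≡ 1 → u ≡ 1 ⊎ w ≡ 1 → v ≡ 1 ⊎ w ≡ 1 →
  u + v + w ≡ 2 + u * v * w
doubly-covered-+ {w = w} (inj₁ refl) _           (inj₁ refl) = solve (w ∷ [])
doubly-covered-+ {v = v} (inj₁ refl) _           (inj₂ refl) = solve (v ∷ [])
doubly-covered-+ {w = w} (inj₂ refl) (inj₁ refl) _           = solve (w ∷ [])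
doubly-covered-+ {u = u} (inj₂ refl) (inj₂ refl) _           = solve (u ∷ [])

covered-apart-+ : ∀ {u v w} → u ≡ 1 ⊎ v ≡ 1 ⊎ w ≡ 1 → u ≡ 0 ⊎ w ≡ 0 →
  u + v + w ≡ 1 + (v * w + u * w + u * v)
covered-apart-+ {v = v} (inj₁ refl)        (inj₂ refl) = solve (v ∷ [])
covered-apart-+ {w = w} (inj₂ (inj₁ refl)) (inj₁ refl) = solve (w ∷ [])
covered-apart-+ {u = u} (inj₂ (inj₁ refl)) (inj₂ refl) = solve (u ∷ [])
covered-apart-+ {v = v} (inj₂ (inj₂ refl)) (inj₁ refl) = solve (v ∷ [])

apart-* : ∀ {u v} → u ≡ 0 ⊎ v ≡ 0 → u * v ≡ 0
apart-* (inj₁ refl)         = refl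
apart-* {u = u} (inj₂ refl) = *-zeroʳ u

module _ {K : ℕ} where

  ∣∩∣-minimal : {u v u′ v′ : Fin K → ℕ} → Cover₂ u v → Bits u′ → Bits v′ →
    ΣFin u ≡ ΣFin u′ → ΣFin v ≡ ΣFin v′ → ∣ u ∩ v ∣ ≤ ∣ u′ ∩ v′ ∣
  ∣∩∣-minimal {u} {v} {u′} {v′} cover bu′ bv′ Σu≡ Σv≡ = ΣFin-tight-minimal 1
    (λ j → covered-+ (cover j)) (λ j → bit-+-≤ (bu′ j) (bv′ j))
    (ΣFin-+-cong {f = u} {v} {u′} {v′} Σu≡ Σv≡)

  ∣∩∩∣-minimal : {u v w u′ v′ w′ : Fin K → ℕ} → Cover₂ u v → Cover₂ u w → Cover₂ v w →
    Bits u′ → Bits v′ → Bits w′ → ΣFin u ≡ ΣFin u′ → ΣFin v ≡ ΣFin v′ → ΣFin w ≡ ΣFin w′ →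
    ∣ u ∩ v ∩ w ∣ ≤ ∣ u′ ∩ v′ ∩ w′ ∣
  ∣∩∩∣-minimal {u} {v} {w} {u′} {v′} {w′} uv uw vw bu′ bv′ bw′ Σu≡ Σv≡ Σw≡ = ΣFin-tight-minimal 2
    (λ j → doubly-covered-+ (uv j) (uw j) (vw j)) (λ j → bit-+-≤₃ (bu′ j) (bv′ j) (bw′ j))
    (ΣFin-+₃-cong u v w u′ v′ w′ Σu≡ Σv≡ Σw≡)

  overlaps-minimal : {u v w u′ v′ w′ : Fin K → ℕ} → Cover₃ u v w → Disjoint u w →
    Bits u′ → Bits v′ → Bits w′ → ΣFin u ≡ ΣFin u′ → ΣFin v ≡ ΣFin v′ → ΣFin w ≡ ΣFin w′ →
    overlaps u v w ≤ overlaps u′ v′ w′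
  overlaps-minimal {u} {v} {w} {u′} {v′} {w′} cover apart bu′ bv′ bw′ Σu≡ Σv≡ Σw≡ =
    subst₂ _≤_ (ΣFin-+₃ (λ j → v j * w j) (λ j → u j * w j) (λ j → u j * v j))
               (ΣFin-+₃ (λ j → v′ j * w′ j) (λ j → u′ j * w′ j) (λ j → u′ j * v′ j))
      (ΣFin-tight-minimal 1
        (λ j → covered-apart-+ (cover j) (apart j)) (λ j → bit-+-≤-overlaps (bu′ j) (bv′ j) (bw′ j))
        (ΣFin-+₃-cong u v w u′ v′ w′ Σu≡ Σv≡ Σw≡))

  ∣∩∣-disjoint : {u v : Fin K → ℕ} → Disjoint u v → ∣ u ∩ v ∣ ≡ 0
  ∣∩∣-disjoint apart = ΣFin-vanishing (λ j → apart-* (apart j))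

  ∣∩∩∣-disjoint : {u v w : Fin K → ℕ} → Disjoint u w → ∣ u ∩ v ∩ w ∣ ≡ 0
  ∣∩∩∣-disjoint {u} {v} {w} apart = ΣFin-vanishing λ j →
    [ (λ u≡0 → cong (λ a → a * v j * w j) u≡0)
    , (λ w≡0 → trans (cong (u j * v j *_) w≡0) (*-zeroʳ (u j * v j))) ] (apart j)

  overlaps-disjoint : {u v w : Fin K → ℕ} → Disjoint u v → Disjoint u w → Disjoint v w →
    overlaps u v w ≡ 0
  overlaps-disjoint uv uw vw =
    cong₂ _+_ (cong₂ _+_ (∣∩∣-disjoint vw) (∣∩∣-disjoint uw)) (∣∩∣-disjoint uv)

interaction-mono : ∀ {K} n₁ n₂ n₃ {u v w u′ v′ w′ : Fin K → ℕ} →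
  ∣ v ∩ w ∣ ≤ ∣ v′ ∩ w′ ∣ → ∣ u ∩ w ∣ ≤ ∣ u′ ∩ w′ ∣ → ∣ u ∩ v ∣ ≤ ∣ u′ ∩ v′ ∣ →
  ∣ u ∩ v ∩ w ∣ ≤ ∣ u′ ∩ v′ ∩ w′ ∣ →
  interaction n₁ n₂ n₃ u v w ≤ interaction n₁ n₂ n₃ u′ v′ w′
interaction-mono n₁ n₂ n₃ vw uw uv uvw =
  +-mono-≤ (+-mono-≤ (+-mono-≤ (*-monoʳ-≤ n₁ vw) (*-monoʳ-≤ n₂ uw)) (*-monoʳ-≤ n₃ uv)) uvw

exchange : ∀ {n₁ n₂ n₃ p₁ p₂ p₃ t q₁ q₂ q₃ s} → n₁ ≤ n₂ → n₁ ≤ n₃ →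
  p₂ ≡ 0 → t ≡ 0 → p₃ ≤ q₃ → p₁ + p₂ + p₃ ≤ q₁ + q₂ + q₃ →
  n₁ * p₁ + n₂ * p₂ + n₃ * p₃ + t ≤ n₁ * q₁ + n₂ * q₂ + n₃ * q₃ + s
exchange {n₁} {n₂} {_} {p₁} {_} {p₃} {_} {q₁} {q₂} {q₃} {s} n₁≤n₂ n₁≤n₃ refl refl p₃≤q₃ Σp≤Σq
  with d , refl ← m≤n⇒∃[o]m+o≡n n₁≤n₃ = begin
    n₁ * p₁ + n₂ * 0 + (n₁ + d) * p₃ + 0  ≡⟨ solve (n₁ ∷ n₂ ∷ d ∷ p₁ ∷ p₃ ∷ []) ⟩
    n₁ * (p₁ + 0 + p₃) + d * p₃           ≤⟨ +-mono-≤ (*-monoʳ-≤ n₁ Σp≤Σq) (*-monoʳ-≤ d p₃≤q₃) ⟩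
    n₁ * (q₁ + q₂ + q₃) + d * q₃          ≡⟨ solve (n₁ ∷ d ∷ q₁ ∷ q₂ ∷ q₃ ∷ []) ⟩
    n₁ * q₁ + n₁ * q₂ + (n₁ + d) * q₃     ≤⟨ +-monoˡ-≤ _ (+-monoʳ-≤ (n₁ * q₁) (*-monoˡ-≤ q₂ n₁≤n₂)) ⟩
    n₁ * q₁ + n₂ * q₂ + (n₁ + d) * q₃     ≤⟨ m≤m+n _ s ⟩
    n₁ * q₁ + n₂ * q₂ + (n₁ + d) * q₃ + s ∎
  where open ≤-Reasoning

interaction-exchange : ∀ {K n₁ n₂ n₃} {u v w v′ w′ : Fin K → ℕ} → n₁ ≤ n₂ → n₁ ≤ n₃ →
  Disjoint u w → ∣ u ∩ v ∣ ≤ ∣ u ∩ v′ ∣ → overlaps u v w ≤ overlaps u v′ w′ →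
  interaction n₁ n₂ n₃ u v w ≤ interaction n₁ n₂ n₃ u v′ w′
interaction-exchange n₁≤n₂ n₁≤n₃ uw-apart uv≤ overlaps≤ =
  exchange n₁≤n₂ n₁≤n₃ (∣∩∣-disjoint uw-apart) (∣∩∩∣-disjoint uw-apart) uv≤ overlaps≤

interaction-swap : ∀ {K} n₁ n₂ n₃ (u v w : Fin K → ℕ) →
  interaction n₁ n₂ n₃ u v w ≡ interaction n₁ n₃ n₂ u w v
interaction-swap n₁ n₂ n₃ u v w = begin
  n₁ * ∣ v ∩ w ∣ + n₂ * ∣ u ∩ w ∣ + n₃ * ∣ u ∩ v ∣ + ∣ u ∩ v ∩ w ∣
    ≡⟨ cong₂ (λ a b → n₁ * a + n₂ * ∣ u ∩ w ∣ + n₃ * ∣ u ∩ v ∣ + b) vw≡wv uvw≡uwv ⟩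
  n₁ * ∣ w ∩ v ∣ + n₂ * ∣ u ∩ w ∣ + n₃ * ∣ u ∩ v ∣ + ∣ u ∩ w ∩ v ∣
    ≡⟨ cong (_+ ∣ u ∩ w ∩ v ∣) (+-right-comm (n₁ * ∣ w ∩ v ∣) (n₂ * ∣ u ∩ w ∣) (n₃ * ∣ u ∩ v ∣)) ⟩
  n₁ * ∣ w ∩ v ∣ + n₃ * ∣ u ∩ v ∣ + n₂ * ∣ u ∩ w ∣ + ∣ u ∩ w ∩ v ∣ ∎
  where
  open ≡-Reasoning
  vw≡wv : ∣ v ∩ w ∣ ≡ ∣ w ∩ v ∣
  vw≡wv = ΣFin-cong λ j → *-comm (v j) (w j)
  uvw≡uwv : ∣ u ∩ v ∩ w ∣ ≡ ∣ u ∩ w ∩ v ∣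
  uvw≡uwv = ΣFin-cong λ j → *-right-comm (u j) (v j) (w j)

productSum : ∀ {K} → ℕ → ℕ → ℕ → (Fin K → ℕ) → (Fin K → ℕ) → (Fin K → ℕ) → ℕ
productSum n₁ n₂ n₃ u v w = ΣFin (λ j → (n₁ + u j) * (n₂ + v j) * (n₃ + w j))

productSum-expansion : ∀ {K} n₁ n₂ n₃ (u v w : Fin K → ℕ) →
  productSum n₁ n₂ n₃ u v w
    ≡ ΣFin {K} (λ _ → n₁ * n₂ * n₃) + (n₂ * n₃ * ΣFin u + n₁ * n₃ * ΣFin v + n₁ * n₂ * ΣFin w)
      + interaction n₁ n₂ n₃ u v w
productSum-expansion {K} n₁ n₂ n₃ u v w = begin
  productSum n₁ n₂ n₃ u v w
    ≡⟨ ΣFin-cong (λ j → expand (u j) (v j) (w j)) ⟩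
  ΣFin (λ j → n₁ * n₂ * n₃ + linear j + nonlinear j)
    ≡⟨ ΣFin-+₃ (λ _ → n₁ * n₂ * n₃) linear nonlinear ⟩
  ΣFin {K} (λ _ → n₁ * n₂ * n₃) + ΣFin linear + ΣFin nonlinear
    ≡⟨ cong₂ (λ a b → ΣFin {K} (λ _ → n₁ * n₂ * n₃) + a + b)
         (ΣFin-linear₃ (n₂ * n₃) (n₁ * n₃) (n₁ * n₂) u v w)
         (trans (ΣFin-+ pairs (λ j → u j * v j * w j)) (cong (_+ ∣ u ∩ v ∩ w ∣)
           (ΣFin-linear₃ n₁ n₂ n₃ (λ j → v j * w j) (λ j → u j * w j) (λ j → u j * v j)))) ⟩
  ΣFin {K} (λ _ → n₁ * n₂ * n₃) + (n₂ * n₃ * ΣFin u + n₁ * n₃ * ΣFin v + n₁ * n₂ * ΣFin w)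
    + interaction n₁ n₂ n₃ u v w ∎
  where
  open ≡-Reasoning
  linear pairs nonlinear : Fin K → ℕ
  linear    j = n₂ * n₃ * u j + n₁ * n₃ * v j + n₁ * n₂ * w j
  pairs     j = n₁ * (v j * w j) + n₂ * (u j * w j) + n₃ * (u j * v j)
  nonlinear j = pairs j + u j * v j * w j
  expand : ∀ a b c → (n₁ + a) * (n₂ + b) * (n₃ + c)
    ≡ n₁ * n₂ * n₃ + (n₂ * n₃ * a + n₁ * n₃ * b + n₁ * n₂ * c)
      + (n₁ * (b * c) + n₂ * (a * c) + n₃ * (a * b) + a * b * c)
  expand a b c = solve (n₁ ∷ n₂ ∷ n₃ ∷ a ∷ b ∷ c ∷ [])

productSum-≤ : ∀ {K} n₁ n₂ n₃ {u v w v′ w′ : Fin K → ℕ} → ΣFin v ≡ ΣFin v′ → ΣFin w ≡ ΣFin w′ →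
  interaction n₁ n₂ n₃ u v w ≤ interaction n₁ n₂ n₃ u v′ w′ →
  productSum n₁ n₂ n₃ u v w ≤ productSum n₁ n₂ n₃ u v′ w′
productSum-≤ {K} n₁ n₂ n₃ {u} {v} {w} {v′} {w′} Σv≡ Σw≡ interaction≤ = begin
  productSum n₁ n₂ n₃ u v w
    ≡⟨ productSum-expansion n₁ n₂ n₃ u v w ⟩
  c + (n₂ * n₃ * ΣFin u + n₁ * n₃ * ΣFin v + n₁ * n₂ * ΣFin w) + interaction n₁ n₂ n₃ u v w
    ≤⟨ +-monoʳ-≤ (c + (n₂ * n₃ * ΣFin u + n₁ * n₃ * ΣFin v + n₁ * n₂ * ΣFin w)) interaction≤ ⟩
  c + (n₂ * n₃ * ΣFin u + n₁ * n₃ * ΣFin v + n₁ * n₂ * ΣFin w) + interaction n₁ n₂ n₃ u v′ w′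
    ≡⟨ cong₂ (λ a b → c + (n₂ * n₃ * ΣFin u + n₁ * n₃ * a + n₁ * n₂ * b) + interaction n₁ n₂ n₃ u v′ w′)
         Σv≡ Σw≡ ⟩
  c + (n₂ * n₃ * ΣFin u + n₁ * n₃ * ΣFin v′ + n₁ * n₂ * ΣFin w′) + interaction n₁ n₂ n₃ u v′ w′
    ≡⟨ productSum-expansion n₁ n₂ n₃ u v′ w′ ⟨
  productSum n₁ n₂ n₃ u v′ w′ ∎
  where
  open ≤-Reasoning
  c : ℕ
  c = ΣFin {K} (λ _ → n₁ * n₂ * n₃)

-- Step vectors and the rotation permutation

<-or-≥ : ∀ m n → m < n ⊎ n ≤ m
<-or-≥ m n with m <? n
... | yes m<n = inj₁ m<n
... | no  m≮n = inj₂ (≮⇒≥ m≮n)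

step : ℕ → ℕ → ℕ
step T i with T ≤? i
... | yes _ = 1
... | no  _ = 0

step-on : ∀ {T i} → T ≤ i → step T i ≡ 1
step-on {T} {i} T≤i with T ≤? i
... | yes _   = refl
... | no  T≰i = contradiction T≤i T≰i

step-off : ∀ {T i} → i < T → step T i ≡ 0
step-off {T} {i} i<T with T ≤? i
... | yes T≤i = contradiction T≤i (<⇒≱ i<T)
... | no  _   = refl

step-bit : ∀ T i → Bit (step T i)
step-bit T i with T ≤? i
... | yes _ = 1b
... | no  _ = 0b

rotPerm-below : ∀ {K N} (j : Fin K) → toℕ j < N → toℕ (rotPerm N j) ≡ toℕ j + (K ∸ N)
rotPerm-below {K} {N} j j<N with toℕ j <? N
... | yes _   = toℕ-fromℕ< _
... | no  j≮N = contradiction j<N j≮N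

rotPerm-above : ∀ {K N} (j : Fin K) → N ≤ toℕ j → toℕ (rotPerm N j) ≡ toℕ j ∸ N
rotPerm-above {K} {N} j N≤j with toℕ j <? N
... | yes j<N = contradiction N≤j (<⇒≱ j<N)
... | no  _   = toℕ-fromℕ< _

rotPerm-inverse : ∀ {K N M} → N + M ≡ K → (j : Fin K) → rotPerm M (rotPerm N j) ≡ j
rotPerm-inverse {K} {N} {M} N+M≡K j with <-or-≥ (toℕ j) N
... | inj₁ j<N = toℕ-injective (begin
  toℕ (rotPerm M (rotPerm N j)) ≡⟨ rotPerm-above (rotPerm N j) M≤r ⟩
  toℕ (rotPerm N j) ∸ M         ≡⟨ cong (_∸ M) r≡j+M ⟩
  toℕ j + M ∸ M                 ≡⟨ m+n∸n≡m (toℕ j) M ⟩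
  toℕ j                         ∎)
  where
  open ≡-Reasoning
  r≡j+M : toℕ (rotPerm N j) ≡ toℕ j + M
  r≡j+M = trans (rotPerm-below j j<N)
    (cong (toℕ j +_) (trans (cong (_∸ N) (sym N+M≡K)) (m+n∸m≡n N M)))
  M≤r : M ≤ toℕ (rotPerm N j)
  M≤r = subst (M ≤_) (sym r≡j+M) (m≤n+m M (toℕ j))
... | inj₂ N≤j = toℕ-injective (begin
  toℕ (rotPerm M (rotPerm N j)) ≡⟨ rotPerm-below (rotPerm N j) r<M ⟩
  toℕ (rotPerm N j) + (K ∸ M)   ≡⟨ cong₂ _+_ (rotPerm-above j N≤j) K∸M≡N ⟩
  toℕ j ∸ N + N                 ≡⟨ m∸n+n≡m N≤j ⟩
  toℕ j                         ∎)
  where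
  open ≡-Reasoning
  K∸M≡N : K ∸ M ≡ N
  K∸M≡N = trans (cong (_∸ M) (sym N+M≡K)) (m+n∸n≡m N M)
  r<M : toℕ (rotPerm N j) < M
  r<M = +-cancelˡ-< N _ M (subst₂ _<_
    (sym (trans (cong (N +_) (rotPerm-above j N≤j)) (m+[n∸m]≡n N≤j))) (sym N+M≡K) (toℕ<n j))

rotation : ∀ {K N} → N ≤ K → Permutation′ K
rotation {K} {N} N≤K = permutation (rotPerm N) (rotPerm (K ∸ N))
  (rotPerm-inverse {N = K ∸ N} (m∸n+n≡m N≤K)) (rotPerm-inverse {N = N} (m+[n∸m]≡n N≤K))

-- The reversed and rotated arrangement of three step vectors

-- Jump positions grouped by the shape of the arrangement u, v, w of ReverseRotate below:
-- supports pairwise disjoint; u the complement of v ∨ w; u ∨ v ≡ 1 and u ∧ w ≡ 0;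
-- u ∨ w ≡ 1 and u ∧ v ≡ 0; every position covered at least twice.
data Regime (K T₁ T₂ T₃ : ℕ) : Set where
  pairwise-disjoint : K ≤ T₁ + T₂ → K ≤ T₁ + T₃ → K + K ≤ T₁ + T₂ + T₃ → Regime K T₁ T₂ T₃
  complementary     : K ≤ T₁ + T₂ → K ≤ T₁ + T₃ → T₁ + T₂ + T₃ ≤ K + K → Regime K T₁ T₂ T₃
  uv-cover          : T₁ + T₂ ≤ K → K ≤ T₁ + T₃ → Regime K T₁ T₂ T₃
  uw-cover          : K ≤ T₁ + T₂ → T₁ + T₃ ≤ K → Regime K T₁ T₂ T₃
  double-cover      : T₁ + T₂ + T₃ ≤ K → Regime K T₁ T₂ T₃

module ReverseRotate {K : ℕ} (T₁ T₂ T₃ : ℕ) (T₁≤K : T₁ ≤ K) where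

  u v w : Fin K → ℕ
  u j = step T₁ (toℕ j)
  v j = step T₂ (toℕ (opposite j))
  w j = step T₃ (toℕ (rotPerm T₁ j))

  bu : Bits u
  bu j = step-bit T₁ (toℕ j)

  opposite+suc : (j : Fin K) → toℕ (opposite j) + suc (toℕ j) ≡ K
  opposite+suc j = trans (cong (_+ suc (toℕ j)) (opposite-prop j)) (m∸n+n≡m (toℕ<n j))

  v-on : (j : Fin K) → T₂ + toℕ j < K → v j ≡ 1
  v-on j T₂+j<K = step-on (+-cancelʳ-≤ (suc (toℕ j)) T₂ _
    (subst₂ _≤_ (sym (+-suc T₂ (toℕ j))) (sym (opposite+suc j)) T₂+j<K))

  v-off : (j : Fin K) → K ≤ T₂ + toℕ j → v j ≡ 0
  v-off j K≤T₂+j = step-off (+-cancelʳ-≤ (toℕ j) _ T₂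
    (subst (_≤ T₂ + toℕ j) (trans (sym (opposite+suc j)) (+-suc _ (toℕ j))) K≤T₂+j))

  rotated-below : (j : Fin K) → toℕ j < T₁ → toℕ (rotPerm T₁ j) + T₁ ≡ toℕ j + K
  rotated-below j j<T₁ = trans (cong (_+ T₁) (rotPerm-below j j<T₁))
    (trans (+-assoc (toℕ j) (K ∸ T₁) T₁) (cong (toℕ j +_) (m∸n+n≡m T₁≤K)))

  rotated-above : (j : Fin K) → T₁ ≤ toℕ j → toℕ (rotPerm T₁ j) + T₁ ≡ toℕ j
  rotated-above j T₁≤j = trans (cong (_+ T₁) (rotPerm-above j T₁≤j)) (m∸n+n≡m T₁≤j)

  rotated-≤ : (j : Fin K) → toℕ (rotPerm T₁ j) + T₁ ≤ toℕ j + K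
  rotated-≤ j with <-or-≥ (toℕ j) T₁
  ... | inj₁ j<T₁ = ≤-reflexive (rotated-below j j<T₁)
  ... | inj₂ T₁≤j = subst (_≤ toℕ j + K) (sym (rotated-above j T₁≤j)) (m≤m+n (toℕ j) K)

  rotated-≥ : (j : Fin K) → toℕ j ≤ toℕ (rotPerm T₁ j) + T₁
  rotated-≥ j with <-or-≥ (toℕ j) T₁
  ... | inj₁ j<T₁ = subst (toℕ j ≤_) (sym (rotated-below j j<T₁)) (m≤m+n (toℕ j) K)
  ... | inj₂ T₁≤j = ≤-reflexive (sym (rotated-above j T₁≤j))

  w-on : (j : Fin K) → T₁ + T₃ ≤ toℕ (rotPerm T₁ j) + T₁ → w j ≡ 1
  w-on j h = step-on (+-cancelʳ-≤ T₁ T₃ _ (subst (_≤ toℕ (rotPerm T₁ j) + T₁) (+-comm T₁ T₃) h))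

  w-off : (j : Fin K) → toℕ (rotPerm T₁ j) + T₁ < T₁ + T₃ → w j ≡ 0
  w-off j h = step-off (+-cancelʳ-< T₁ _ T₃ (subst (toℕ (rotPerm T₁ j) + T₁ <_) (+-comm T₁ T₃) h))

  T₁+T₂+T₃≡T₂+[T₁+T₃] : T₁ + T₂ + T₃ ≡ T₂ + (T₁ + T₃)
  T₁+T₂+T₃≡T₂+[T₁+T₃] = solve (T₁ ∷ T₂ ∷ T₃ ∷ [])

  disjoint-u-v : K ≤ T₁ + T₂ → Disjoint u v
  disjoint-u-v K≤ j with <-or-≥ (toℕ j) T₁
  ... | inj₁ j<T₁ = inj₁ (step-off j<T₁)
  ... | inj₂ T₁≤j = inj₂ (v-off j
    (≤-trans K≤ (subst (T₁ + T₂ ≤_) (+-comm (toℕ j) T₂) (+-monoˡ-≤ T₂ T₁≤j))))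

  disjoint-u-w : K ≤ T₁ + T₃ → Disjoint u w
  disjoint-u-w K≤ j with <-or-≥ (toℕ j) T₁
  ... | inj₁ j<T₁ = inj₁ (step-off j<T₁)
  ... | inj₂ T₁≤j = inj₂ (w-off j
    (subst (_< T₁ + T₃) (sym (rotated-above j T₁≤j)) (<-≤-trans (toℕ<n j) K≤)))

  disjoint-v-w : K + K ≤ T₁ + T₂ + T₃ → Disjoint v w
  disjoint-v-w 2K≤ j with <-or-≥ (T₂ + toℕ j) K
  ... | inj₂ K≤T₂+j = inj₁ (v-off j K≤T₂+j)
  ... | inj₁ T₂+j<K = inj₂ (w-off j (≤-<-trans (rotated-≤ j) (+-cancelˡ-< T₂ _ _ (begin-strict
    T₂ + (toℕ j + K) ≡⟨ +-assoc T₂ (toℕ j) K ⟨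
    T₂ + toℕ j + K   <⟨ +-monoˡ-< K T₂+j<K ⟩
    K + K            ≤⟨ 2K≤ ⟩
    T₁ + T₂ + T₃     ≡⟨ T₁+T₂+T₃≡T₂+[T₁+T₃] ⟩
    T₂ + (T₁ + T₃)   ∎))))
    where open ≤-Reasoning

  cover-u-v : T₁ + T₂ ≤ K → Cover₂ u v
  cover-u-v ≤K j with <-or-≥ (toℕ j) T₁
  ... | inj₁ j<T₁ = inj₂ (v-on j (<-≤-trans (+-monoʳ-< T₂ j<T₁) (subst (_≤ K) (+-comm T₁ T₂) ≤K)))
  ... | inj₂ T₁≤j = inj₁ (step-on T₁≤j)

  cover-u-w : T₁ + T₃ ≤ K → Cover₂ u w
  cover-u-w ≤K j with <-or-≥ (toℕ j) T₁
  ... | inj₁ j<T₁ = inj₂ (w-on j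
    (subst (T₁ + T₃ ≤_) (sym (rotated-below j j<T₁)) (≤-trans ≤K (m≤n+m K (toℕ j)))))
  ... | inj₂ T₁≤j = inj₁ (step-on T₁≤j)

  cover-v-w : T₁ + T₂ + T₃ ≤ K → Cover₂ v w
  cover-v-w ≤K j with <-or-≥ (T₂ + toℕ j) K
  ... | inj₁ T₂+j<K = inj₁ (v-on j T₂+j<K)
  ... | inj₂ K≤T₂+j = inj₂ (w-on j (≤-trans (+-cancelˡ-≤ T₂ _ _ (begin
    T₂ + (T₁ + T₃) ≡⟨ T₁+T₂+T₃≡T₂+[T₁+T₃] ⟨
    T₁ + T₂ + T₃   ≤⟨ ≤K ⟩
    K              ≤⟨ K≤T₂+j ⟩
    T₂ + toℕ j     ∎)) (rotated-≥ j)))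
    where open ≤-Reasoning

  cover-u-v-w : T₁ + T₂ + T₃ ≤ K + K → Cover₃ u v w
  cover-u-v-w ≤2K j with <-or-≥ (toℕ j) T₁ | <-or-≥ (T₂ + toℕ j) K
  ... | inj₂ T₁≤j | _           = inj₁ (step-on T₁≤j)
  ... | inj₁ _    | inj₁ T₂+j<K = inj₂ (inj₁ (v-on j T₂+j<K))
  ... | inj₁ j<T₁ | inj₂ K≤T₂+j = inj₂ (inj₂ (w-on j (subst (T₁ + T₃ ≤_) (sym (rotated-below j j<T₁))
    (+-cancelˡ-≤ T₂ _ _ (begin
      T₂ + (T₁ + T₃)   ≡⟨ T₁+T₂+T₃≡T₂+[T₁+T₃] ⟨
      T₁ + T₂ + T₃     ≤⟨ ≤2K ⟩
      K + K            ≤⟨ +-monoˡ-≤ K K≤T₂+j ⟩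
      T₂ + toℕ j + K   ≡⟨ +-assoc T₂ (toℕ j) K ⟩
      T₂ + (toℕ j + K) ∎)))))
    where open ≤-Reasoning

  interaction-optimal : ∀ {n₁ n₂ n₃} {v′ w′ : Fin K → ℕ} → Regime K T₁ T₂ T₃ → n₁ ≤ n₂ → n₁ ≤ n₃ →
    Bits v′ → Bits w′ → ΣFin v ≡ ΣFin v′ → ΣFin w ≡ ΣFin w′ →
    interaction n₁ n₂ n₃ u v w ≤ interaction n₁ n₂ n₃ u v′ w′
  interaction-optimal {n₁} {n₂} {n₃} {v′} {w′} regime n₁≤n₂ n₁≤n₃ bv′ bw′ Σv≡ Σw≡ with regime
  ... | pairwise-disjoint K≤₁₂ K≤₁₃ 2K≤ =
    interaction-exchange n₁≤n₂ n₁≤n₃ (disjoint-u-w K≤₁₃)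
      (subst (_≤ ∣ u ∩ v′ ∣) (sym (∣∩∣-disjoint (disjoint-u-v K≤₁₂))) z≤n)
      (subst (_≤ overlaps u v′ w′)
        (sym (overlaps-disjoint (disjoint-u-v K≤₁₂) (disjoint-u-w K≤₁₃) (disjoint-v-w 2K≤))) z≤n)
  ... | complementary K≤₁₂ K≤₁₃ ≤2K =
    interaction-exchange n₁≤n₂ n₁≤n₃ (disjoint-u-w K≤₁₃)
      (subst (_≤ ∣ u ∩ v′ ∣) (sym (∣∩∣-disjoint (disjoint-u-v K≤₁₂))) z≤n)
      (overlaps-minimal (cover-u-v-w ≤2K) (disjoint-u-w K≤₁₃) bu bv′ bw′ refl Σv≡ Σw≡)
  ... | uv-cover ≤K K≤ =
    interaction-exchange n₁≤n₂ n₁≤n₃ (disjoint-u-w K≤)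
      (∣∩∣-minimal (cover-u-v ≤K) bu bv′ refl Σv≡)
      (overlaps-minimal (λ j → [ inj₁ , inj₂ ∘ inj₁ ] (cover-u-v ≤K j)) (disjoint-u-w K≤)
        bu bv′ bw′ refl Σv≡ Σw≡)
  ... | uw-cover K≤ ≤K =
    subst₂ _≤_ (sym (interaction-swap n₁ n₂ n₃ u v w)) (sym (interaction-swap n₁ n₂ n₃ u v′ w′))
      (interaction-exchange n₁≤n₃ n₁≤n₂ (disjoint-u-v K≤)
        (∣∩∣-minimal (cover-u-w ≤K) bu bw′ refl Σw≡)
        (overlaps-minimal (λ j → [ inj₁ , inj₂ ∘ inj₁ ] (cover-u-w ≤K j)) (disjoint-u-v K≤)
          bu bw′ bv′ refl Σw≡ Σv≡))
  ... | double-cover ≤K =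
    interaction-mono n₁ n₂ n₃ {u} {v} {w} {u} {v′} {w′}
      (∣∩∣-minimal vw bv′ bw′ Σv≡ Σw≡) (∣∩∣-minimal uw bu bw′ refl Σw≡) (∣∩∣-minimal uv bu bv′ refl Σv≡)
      (∣∩∩∣-minimal uv uw vw bu bv′ bw′ refl Σv≡ Σw≡)
    where
    uv : Cover₂ u v
    uv = cover-u-v (≤-trans (m≤m+n (T₁ + T₂) T₃) ≤K)
    uw : Cover₂ u w
    uw = cover-u-w (≤-trans (+-monoˡ-≤ T₃ (m≤m+n T₁ T₂)) ≤K)
    vw : Cover₂ v w
    vw = cover-v-w ≤K

  optimal : ∀ {n₁ n₂ n₃} → Regime K T₁ T₂ T₃ → n₁ ≤ n₂ → n₁ ≤ n₃ → (σ₁ σ₂ : Permutation′ K) →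
    productSum n₁ n₂ n₃ u v w
      ≤ productSum n₁ n₂ n₃ u (λ j → step T₂ (toℕ (σ₁ ⟨$⟩ʳ j))) (λ j → step T₃ (toℕ (σ₂ ⟨$⟩ʳ j)))
  optimal {n₁} {n₂} {n₃} regime n₁≤n₂ n₁≤n₃ σ₁ σ₂ = productSum-≤ n₁ n₂ n₃ {u} Σv≡ Σw≡
    (interaction-optimal regime n₁≤n₂ n₁≤n₃ (λ j → step-bit T₂ _) (λ j → step-bit T₃ _) Σv≡ Σw≡)
    where
    Σv≡ : ΣFin v ≡ ΣFin (λ j → step T₂ (toℕ (σ₁ ⟨$⟩ʳ j)))
    Σv≡ = trans (ΣFin-permute {K} (step T₂ ∘ toℕ) reverse) (sym (ΣFin-permute (step T₂ ∘ toℕ) σ₁))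
    Σw≡ : ΣFin w ≡ ΣFin (λ j → step T₃ (toℕ (σ₂ ⟨$⟩ʳ j)))
    Σw≡ = trans (ΣFin-permute {K} (step T₃ ∘ toℕ) (rotation T₁≤K)) (sym (ΣFin-permute (step T₃ ∘ toℕ) σ₂))

-- Block-shaped vectors

data Threshold (m Q : ℕ) : ℕ → Set where
  at-m : Threshold m Q m
  at-Q : Threshold m Q Q

threshold-≤ : ∀ {K m Q T} → K ≡ Q + m → Threshold m Q T → T ≤ K
threshold-≤ {m = m} {Q} K≡Q+m at-m = subst (m ≤_) (sym K≡Q+m) (m≤n+m m Q)
threshold-≤ {m = m} {Q} K≡Q+m at-Q = subst (Q ≤_) (sym K≡Q+m) (m≤m+n Q m)

step-shape : ∀ {K T n} {x : Fin K → ℕ} →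
  (∀ j → toℕ j < T → x j ≡ n) → (∀ j → T ≤ toℕ j → x j ≡ suc n) → ∀ j → x j ≡ n + step T (toℕ j)
step-shape {T = T} {n} below above j with <-or-≥ (toℕ j) T
... | inj₁ j<T = trans (below j j<T) (sym (trans (cong (n +_) (step-off j<T)) (+-identityʳ n)))
... | inj₂ T≤j = trans (above j T≤j) (sym (trans (cong (n +_) (step-on T≤j)) (+-comm n 1)))

blockShape⇒step : ∀ {m n} {x : Fin (m * m) → ℕ} → BlockShape m x n →
  Σ ℕ λ T → Threshold m (m * (m ∸ 1)) T × (∀ j → x j ≡ n + step T (toℕ j))
blockShape⇒step {m} {n} {x} (c , n≤c , c≤1+n , shape) with m≤n⇒m<n∨m≡n n≤c
... | inj₂ refl = m * (m ∸ 1) , at-Q , step-shape below (λ j → proj₂ (proj₂ (shape j)))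
  where
  below : ∀ j → toℕ j < m * (m ∸ 1) → x j ≡ n
  below j j<Q with <-or-≥ (toℕ j) m
  ... | inj₁ j<m = proj₁ (shape j) j<m
  ... | inj₂ m≤j = proj₁ (proj₂ (shape j)) m≤j j<Q
... | inj₁ n<c with ≤-antisym c≤1+n n<c
...   | refl = m , at-m , step-shape (λ j → proj₁ (shape j)) above
  where
  above : ∀ j → m ≤ toℕ j → x j ≡ suc n
  above j m≤j with <-or-≥ (toℕ j) (m * (m ∸ 1))
  ... | inj₁ j<Q = proj₁ (proj₂ (shape j)) m≤j j<Q
  ... | inj₂ Q≤j = proj₂ (proj₂ (shape j)) Q≤j

≡ᵇ-shift : ∀ n s → (n + s ≡ᵇ n) ≡ (s ≡ᵇ 0)
≡ᵇ-shift zero    s = refl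
≡ᵇ-shift (suc n) s = ≡ᵇ-shift n s

countEq-step : ∀ {K T n} {x : Fin K → ℕ} → T ≤ K → (∀ j → x j ≡ n + step T (toℕ j)) →
  countEq x n ≡ T
countEq-step {T = T} {n} {x} T≤K x≡ =
  ΣFin-prefix T≤K (λ j j<T → indicator j (step-off j<T)) (λ j T≤j → indicator j (step-on T≤j))
  where
  indicator : ∀ j {s} → step T (toℕ j) ≡ s → (if x j ≡ᵇ n then 1 else 0) ≡ (if s ≡ᵇ 0 then 1 else 0)
  indicator j refl = cong (λ b → if b then 1 else 0) (trans (cong (_≡ᵇ n) (x≡ j)) (≡ᵇ-shift n _))

block-regime : ∀ {K m Q T₁ T₂ T₃} → K ≡ Q + m → m + m ≤ Q →
  Threshold m Q T₁ → Threshold m Q T₂ → Threshold m Q T₃ → Regime K T₁ T₂ T₃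
block-regime {K} {m} {Q} K≡Q+m 2m≤Q = classify
  where
  m≤Q : m ≤ Q
  m≤Q = ≤-trans (m≤m+n m m) 2m≤Q
  K≤Q+m : K ≤ Q + m
  K≤Q+m = ≤-reflexive K≡Q+m
  K≤m+Q : K ≤ m + Q
  K≤m+Q = ≤-reflexive (trans K≡Q+m (+-comm Q m))
  K≤Q+Q : K ≤ Q + Q
  K≤Q+Q = ≤-trans K≤Q+m (+-monoʳ-≤ Q m≤Q)
  m+m≤K : m + m ≤ K
  m+m≤K = ≤-trans 2m≤Q (subst (Q ≤_) (sym K≡Q+m) (m≤m+n Q m))
  m+m+m≤K : m + m + m ≤ K
  m+m+m≤K = subst (m + m + m ≤_) (sym K≡Q+m) (+-monoˡ-≤ m 2m≤Q)
  Q+m+Q≤K+K : Q + m + Q ≤ K + K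
  Q+m+Q≤K+K =
    subst (Q + m + Q ≤_) (trans (+-assoc (Q + m) Q m) (sym (cong₂ _+_ K≡Q+m K≡Q+m))) (m≤m+n _ m)
  K+K≤Q+Q+Q : K + K ≤ Q + Q + Q
  K+K≤Q+Q+Q = begin
    K + K           ≡⟨ cong₂ _+_ K≡Q+m K≡Q+m ⟩
    Q + m + (Q + m) ≡⟨ solve (Q ∷ m ∷ []) ⟩
    Q + Q + (m + m) ≤⟨ +-monoʳ-≤ (Q + Q) 2m≤Q ⟩
    Q + Q + Q       ∎
    where open ≤-Reasoning
  classify : ∀ {T₁ T₂ T₃} →
    Threshold m Q T₁ → Threshold m Q T₂ → Threshold m Q T₃ → Regime K T₁ T₂ T₃
  classify at-Q at-Q at-Q = pairwise-disjoint K≤Q+Q K≤Q+Q K+K≤Q+Q+Q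
  classify at-Q at-m at-Q = complementary K≤Q+m K≤Q+Q Q+m+Q≤K+K
  classify at-Q at-Q at-m =
    complementary K≤Q+Q K≤Q+m (subst (_≤ K + K) (+-right-comm Q m Q) Q+m+Q≤K+K)
  classify at-Q at-m at-m =
    complementary K≤Q+m K≤Q+m (≤-trans (+-monoʳ-≤ (Q + m) m≤Q) Q+m+Q≤K+K)
  classify at-m at-Q at-Q =
    complementary K≤m+Q K≤m+Q (subst (_≤ K + K) (cong (_+ Q) (+-comm Q m)) Q+m+Q≤K+K)
  classify at-m at-m at-Q = uv-cover m+m≤K K≤m+Q
  classify at-m at-Q at-m = uw-cover K≤m+Q m+m≤K
  classify at-m at-m at-m = double-cover m+m+m≤K

m*m≡m*[m∸1]+m : ∀ m → m * m ≡ m * (m ∸ 1) + m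
m*m≡m*[m∸1]+m zero    = refl
m*m≡m*[m∸1]+m (suc k) = trans (*-suc (suc k) k) (+-comm (suc k) (suc k * k))

m+m≤m*[m∸1] : ∀ {m} → 3 ≤ m → m + m ≤ m * (m ∸ 1)
m+m≤m*[m∸1] {suc k} (s≤s 2≤k) = begin
  suc k + suc k ≡⟨ solve (k ∷ []) ⟩
  suc k * 2     ≤⟨ *-monoʳ-≤ (suc k) 2≤k ⟩
  suc k * k     ∎
  where open ≤-Reasoning

mainTheorem7 : (m : ℕ) → 3 ≤ m →
    (x₁ x₂ x₃ : Fin (m * m) → ℕ) → (n₁ n₂ n₃ : ℕ) →
    BlockShape m x₁ n₁ → BlockShape m x₂ n₂ → BlockShape m x₃ n₃ →
    n₁ ≤ n₂ → n₁ ≤ n₃ →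
    (σ₁ σ₂ : Permutation′ (m * m)) →
    ΣFin (λ j → x₁ j * x₂ (revPerm j) * x₃ (rotPerm (countEq x₁ n₁) j))
      ≤ ΣFin (λ j → x₁ j * x₂ (σ₁ ⟨$⟩ʳ j) * x₃ (σ₂ ⟨$⟩ʳ j))
mainTheorem7 m 3≤m x₁ x₂ x₃ n₁ n₂ n₃ B₁ B₂ B₃ n₁≤n₂ n₁≤n₃ σ₁ σ₂
  with T₁ , t₁ , x₁≡ ← blockShape⇒step B₁
     | T₂ , t₂ , x₂≡ ← blockShape⇒step B₂
     | T₃ , t₃ , x₃≡ ← blockShape⇒step B₃ = begin
  ΣFin (λ j → x₁ j * x₂ (revPerm j) * x₃ (rotPerm (countEq x₁ n₁) j))
    ≡⟨ ΣFin-cong (λ j → cong₂ _*_ (cong₂ _*_ (x₁≡ j) (x₂≡ (opposite j)))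
         (trans (cong (λ N → x₃ (rotPerm N j)) (countEq-step T₁≤K x₁≡)) (x₃≡ (rotPerm T₁ j)))) ⟩
  productSum n₁ n₂ n₃ u v w
    ≤⟨ optimal (block-regime (m*m≡m*[m∸1]+m m) (m+m≤m*[m∸1] 3≤m) t₁ t₂ t₃) n₁≤n₂ n₁≤n₃ σ₁ σ₂ ⟩
  productSum n₁ n₂ n₃ u (λ j → step T₂ (toℕ (σ₁ ⟨$⟩ʳ j))) (λ j → step T₃ (toℕ (σ₂ ⟨$⟩ʳ j)))
    ≡⟨ ΣFin-cong (λ j → cong₂ _*_ (cong₂ _*_ (x₁≡ j) (x₂≡ (σ₁ ⟨$⟩ʳ j))) (x₃≡ (σ₂ ⟨$⟩ʳ j))) ⟨
  ΣFin (λ j → x₁ j * x₂ (σ₁ ⟨$⟩ʳ j) * x₃ (σ₂ ⟨$⟩ʳ j)) ∎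
  where
  T₁≤K : T₁ ≤ m * m
  T₁≤K = threshold-≤ (m*m≡m*[m∸1]+m m) t₁
  open ≤-Reasoning
  open ReverseRotate T₁ T₂ T₃ T₁≤K
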